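{- For a positive integer $s$, let $F(s)$ denote the set of positive integers $n$ such that $(s,p,n)$ is admissible for some positive integer $p$. Then: (a) $3\notin F(s)$ for $s\in\{11,12,15,18\}$, and $4\notin F(13)$; (b) $3\in F(s)$ for $s\in\{13,14,16,17\}$, and $4\in F(12)$.
   Context: For a multiset $\{x_1,\dots,x_n\}$ of positive integers define $T\{x_1,\dots,x_n\}=(x_1+\cdots+x_n,\,x_1x_2\cdots x_n,\,n)$. An ordered triple $(s,p,n)$ of positive integers is called admissible if there exist at least two different multisets $X$, $Y$ of $n$ positive integers with $T(X)=T(Y)=(s,p,n)$. -}

module Defs where

open import Data.Nat using (ℕ; _<_; _≥_)
open import Data.List using (List; length)
open import Data.Nat.ListAction using (sum; product)
open import Relation.Binary.PropositionalEquality using (_≡_)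
open import Data.List.Relation.Unary.All using (All)
open import Data.List.Relation.Binary.Permutation.Propositional using (_↭_)
open import Data.Product using (Σ; _×_; ∃)
open import Relation.Nullary using (¬_)

-- A multiset of positive integers is represented by a list of naturals, all ≥ 1;
-- two lists represent the same multiset iff they are permutations of each other.

HasT : List ℕ → ℕ → ℕ → ℕ → Set
HasT X s p n = All (λ x → 0 < x) X × sum X ≡ s × product X ≡ p × length X ≡ n

Admissible : ℕ → ℕ → ℕ → Set
Admissible s p n = Σ (List ℕ) λ X → Σ (List ℕ) λ Y → HasT X s p n × HasT Y s p n × ¬ (X ↭ Y)

InF : ℕ → ℕ → Set
InF n s = 0 < n × ∃ λ p → 0 < p × Admissible s p n

-- A multiset of n positive integers with sum s is, in some order, a composition of s
-- into n positive parts. So n ∉ F(s) is a finite check: any two compositions with the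
-- same product must be permutations of each other, and permutation of lists of
-- naturals is decidable by comparing sorted forms.

module Submission where

open import Defs
open import Data.Nat using (ℕ; zero; suc; _+_; _∸_; _<_; _<?_; _≟_; z<s; s≤s; >-nonZero; >-nonZero⁻¹)
open import Data.Nat.Properties using (≤-decTotalOrder; ≤-totalOrder; m≤m+n; m+n∸m≡n)
open import Data.Nat.ListAction using (sum; product)
open import Data.Nat.ListAction.Properties using (product≢0)
open import Data.List using (List; []; _∷_; [_]; length; map; concatMap; upTo)
open import Data.List.Properties using (≡-dec)
open import Data.List.Membership.Propositional using (_∈_)
open import Data.List.Membership.Propositional.Properties using (∈-map⁺; ∈-concat⁺′; ∈-upTo⁺)
open import Data.List.Relation.Unary.All as All using (All; []; _∷_; all?)
open import Data.List.Relation.Unary.Any using (here)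
open import Data.List.Relation.Binary.Equality.Propositional using (≋⇒≡)
open import Data.List.Relation.Binary.Permutation.Propositional using (_↭_; ↭-refl; ↭-sym; ↭-trans; ↭⇒↭ₛ)
open import Data.List.Relation.Unary.Sorted.TotalOrder.Properties using (↗↭↗⇒≋)
open import Data.List.Sort.InsertionSort ≤-decTotalOrder using (insertionSort)
open import Data.List.Sort.Base ≤-totalOrder using (SortingAlgorithm)
open import Data.Empty using (⊥-elim)
open import Data.Product using (_×_; _,_)
open import Relation.Binary.Definitions using (Decidable)
open import Relation.Binary.PropositionalEquality using (_≡_; refl; sym; subst; subst₂)
open import Relation.Nullary using (¬_; Dec)
open import Relation.Nullary.Decidable using (map′; _→-dec_; True; False; toWitness; toWitnessFalse)

open SortingAlgorithm insertionSort using (sort; sort-↭; sort-↗)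

↭⇒sort≡ : ∀ {X Y : List ℕ} → X ↭ Y → sort X ≡ sort Y
↭⇒sort≡ {X} {Y} X↭Y = ≋⇒≡ (↗↭↗⇒≋ ≤-totalOrder (sort-↗ X) (sort-↗ Y)
  (↭⇒↭ₛ (↭-trans (sort-↭ X) (↭-trans X↭Y (↭-sym (sort-↭ Y))))))

sort≡⇒↭ : ∀ {X Y : List ℕ} → sort X ≡ sort Y → X ↭ Y
sort≡⇒↭ {X} {Y} eq = ↭-trans (↭-sym (sort-↭ X)) (subst (_↭ Y) (sym eq) (sort-↭ Y))

_↭?_ : Decidable {A = List ℕ} _↭_
X ↭? Y = map′ sort≡⇒↭ ↭⇒sort≡ (≡-dec _≟_ (sort X) (sort Y))

compositions : ℕ → ℕ → List (List ℕ)
compositions zero    zero    = [ [] ]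
compositions zero    (suc _) = []
compositions (suc n) s =
  concatMap (λ x → map (suc x ∷_) (compositions n (s ∸ suc x))) (upTo s)

∈-compositions : ∀ {X} → All (0 <_) X → X ∈ compositions (length X) (sum X)
∈-compositions []                      = here refl
∈-compositions {suc x ∷ X} (z<s ∷ X>0) =
  ∈-concat⁺′ (∈-map⁺ (suc x ∷_) X∈) (∈-map⁺ _ (∈-upTo⁺ (s≤s (m≤m+n x (sum X)))))
  where
  X∈ : X ∈ compositions (length X) (suc x + sum X ∸ suc x)
  X∈ = subst (λ t → X ∈ compositions (length X) t) (sym (m+n∸m≡n (suc x) (sum X))) (∈-compositions X>0)

ProductDeterminesMultiset : ℕ → ℕ → Set
ProductDeterminesMultiset n s =
  All (λ X → All (λ Y → product X ≡ product Y → X ↭ Y) (compositions n s)) (compositions n s)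

productDeterminesMultiset? : ∀ n s → Dec (ProductDeterminesMultiset n s)
productDeterminesMultiset? n s =
  all? (λ X → all? (λ Y → (product X ≟ product Y) →-dec (X ↭? Y)) (compositions n s)) (compositions n s)

productDeterminesMultiset⇒¬InF : ∀ {n s} → ProductDeterminesMultiset n s → ¬ InF n s
productDeterminesMultiset⇒¬InF det (_ , _ , _ , X , Y , (X>0 , refl , refl , refl) , (Y>0 , ΣY , ΠY , ∣Y∣) , X≁Y) =
  X≁Y (All.lookup (All.lookup det (∈-compositions X>0)) Y∈ (sym ΠY))
  where
  Y∈ : Y ∈ compositions (length X) (sum X)
  Y∈ = subst₂ (λ n s → Y ∈ compositions n s) ∣Y∣ ΣY (∈-compositions Y>0)

distinct⇒InF : (X Y : List ℕ) → All (0 <_) X → All (0 <_) Y → ¬ (X ↭ Y) →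
  length X ≡ length Y → sum X ≡ sum Y → product X ≡ product Y → InF (length X) (sum X)
distinct⇒InF [] []      _ _ X≁Y _  _ _ = ⊥-elim (X≁Y ↭-refl)
distinct⇒InF [] (_ ∷ _) _ _ _   () _ _
distinct⇒InF X@(_ ∷ _) Y X>0 Y>0 X≁Y ∣X∣≡∣Y∣ ΣX≡ΣY ΠX≡ΠY =
  z<s , product X , >-nonZero⁻¹ _ {{product≢0 (All.map >-nonZero X>0)}} , X , Y
  , (X>0 , refl , refl , refl) , (Y>0 , sym ΣX≡ΣY , sym ΠX≡ΠY , sym ∣X∣≡∣Y∣) , X≁Y

lemma2p4 : ((¬ InF 3 11) × (¬ InF 3 12) × (¬ InF 3 15) × (¬ InF 3 18) × (¬ InF 4 13))
             × (InF 3 13 × InF 3 14 × InF 3 16 × InF 3 17 × InF 4 12)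
lemma2p4 = (by-enumeration 3 11 , by-enumeration 3 12 , by-enumeration 3 15 , by-enumeration 3 18 , by-enumeration 4 13)
         , ( by-example (1 ∷ 6 ∷ 6 ∷ []) (2 ∷ 2 ∷ 9 ∷ []) refl refl refl
           , by-example (1 ∷ 5 ∷ 8 ∷ []) (2 ∷ 2 ∷ 10 ∷ []) refl refl refl
           , by-example (2 ∷ 5 ∷ 9 ∷ []) (3 ∷ 3 ∷ 10 ∷ []) refl refl refl
           , by-example (3 ∷ 6 ∷ 8 ∷ []) (4 ∷ 4 ∷ 9 ∷ []) refl refl refl
           , by-example (1 ∷ 3 ∷ 4 ∷ 4 ∷ []) (2 ∷ 2 ∷ 2 ∷ 6 ∷ []) refl refl refl)
  where
  by-enumeration : ∀ n s → {True (productDeterminesMultiset? n s)} → ¬ InF n s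
  by-enumeration n s {det} = productDeterminesMultiset⇒¬InF (toWitness det)

  by-example : (X Y : List ℕ) {_ : True (all? (0 <?_) X)} {_ : True (all? (0 <?_) Y)} {_ : False (X ↭? Y)} →
    length X ≡ length Y → sum X ≡ sum Y → product X ≡ product Y → InF (length X) (sum X)
  by-example X Y {X>0} {Y>0} {X≁Y} = distinct⇒InF X Y (toWitness X>0) (toWitness Y>0) (toWitnessFalse X≁Y)
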